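{- Let $(A,\mathbf{U}_A)$ and $(B,\mathbf{U}_B)$ be uniform groupoids and $T$ a prestrategy from $A$ to $B$. Let $\mathbf{S}\subseteq\mathbf{U}_A$ be a class such that $(A,\mathrm{id}_A)\in\mathbf{S}$ and $\mathbf{U}_A=\mathbf{S}^{\perp\perp}$. Then $T\in\mathbf{U}_{A\multimap B}$ if and only if both of the following hold: (1) for all $S\in\mathbf{S}$, $T@S\in\mathbf{U}_B$; (2) $(T,\partial^T_A)\in\mathbf{U}_A^\perp$.
   Context: All groupoids are small. $\mathbf{Gpd}$ is the $2$-category of groupoids, functors and natural transformations. Prestrategies. A prestrategy on a groupoid $A$ is a pair $(S,\partial^S)$ with $\partial^S:S\to A$ a functor. A prestrategy from $A$ to $B$ is a prestrategy on $A\times B$, with $\partial^S=\langle\partial^S_A,\partial^S_B\rangle$. Bipullbacks. For a cospan $S\xrightarrow{u}B\xleftarrow{v}T$ in $\mathbf{Gpd}$: - a pseudocone with vertex $X$ is $(l':X\to S,\ r':X\to T,\ \nu:ul'\Rightarrow vr')$; - a morphism of pseudocones $(l',r',\nu)\to(l'',r'',\nu'')$ is a pair $\alpha:l'\Rightarrow l''$, $\beta:r'\Rightarrow r''$ with $\nu''\circ(u\alpha)=(v\beta)\circ\nu$; - a pseudocone $(P,l,r,\mu)$ is a bipullback if for every groupoid $X$ the functor $\mathbf{Gpd}(X,P)\to\{\text{pseudocones with vertex }X\}$, $h\mapsto(lh,rh,\mu h)$, $\theta\mapsto(l\theta,r\theta)$, is an equivalence of categories; - a commuting square is regarded as a pseudocone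 with identity $2$-cell. Uniform groupoids. Prestrategies $S,T$ on $B$ are uniformly orthogonal, $S\perp T$, iff the pullback of $S\xrightarrow{\partial^S}B\xleftarrow{\partial^T}T$ is a bipullback. For a class $\mathbf{S}$ of prestrategies on $B$, $\mathbf{S}^\perp=\{T\mid\forall S\in\mathbf{S},S\perp T\}$. A uniform groupoid is $(A,\mathbf{U}_A)$ with $\mathbf{U}_A$ a class of prestrategies on $A$ such that $\mathbf{U}_A^{\perp\perp}=\mathbf{U}_A$. Linear arrow. $A\multimap B$ is the uniform groupoid with underlying groupoid $A\times B$ and $\mathbf{U}_{A\multimap B}=\{(S\times U,\partial^S\times\partial^U)\mid S\in\mathbf{U}_A,U\in\mathbf{U}_B^\perp\}^\perp$. Application. For $S$ a prestrategy on $A$ and $T$ a prestrategy from $A$ to $B$, $T@S$ is the prestrategy on $B$ given by the pullback $P$ of $S\xrightarrow{\partial^S}A\xleftarrow{\partial^T_A}T$, with display $\partial^T_B\circ r$ where $r:P\to T$ is the projection. -}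

module Defs where

open import Level using (0ℓ)
open import Data.Product using (Σ; Σ-syntax; _×_; _,_; proj₁; proj₂)
open import Relation.Binary using (IsEquivalence; Setoid)
open import Relation.Binary.PropositionalEquality using (_≡_; refl)
import Relation.Binary.Reasoning.MultiSetoid as SetoidR

record Groupoid : Set₁ where
  infixr 9 _∘_
  infix 4 _≈_
  infix 10 _⁻¹
  field
    Obj : Set
    Hom : Obj → Obj → Set
    _≈_ : ∀ {a b} → Hom a b → Hom a b → Set
    ≈-equiv : ∀ {a b} → IsEquivalence (_≈_ {a} {b})
    id : ∀ {a} → Hom a a
    _∘_ : ∀ {a b c} → Hom b c → Hom a b → Hom a c
    _⁻¹ : ∀ {a b} → Hom a b → Hom b a
    assoc : ∀ {a b c d} {f : Hom a b} {g : Hom b c} {h : Hom c d} →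
            (h ∘ g) ∘ f ≈ h ∘ (g ∘ f)
    identityˡ : ∀ {a b} {f : Hom a b} → id ∘ f ≈ f
    identityʳ : ∀ {a b} {f : Hom a b} → f ∘ id ≈ f
    inverseˡ : ∀ {a b} {f : Hom a b} → f ⁻¹ ∘ f ≈ id
    inverseʳ : ∀ {a b} {f : Hom a b} → f ∘ f ⁻¹ ≈ id
    ∘-resp-≈ : ∀ {a b c} {f f' : Hom b c} {g g' : Hom a b} →
               f ≈ f' → g ≈ g' → f ∘ g ≈ f' ∘ g'

  module ≈ {a b} = IsEquivalence (≈-equiv {a} {b})

  homSetoid : Obj → Obj → Setoid 0ℓ 0ℓ
  homSetoid a b = record { Carrier = Hom a b ; _≈_ = _≈_ ; isEquivalence = ≈-equiv }

  τ : ∀ {a b} → a ≡ b → Hom a b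
  τ refl = id


record Functor (X Y : Groupoid) : Set where
  private
    module X = Groupoid X
    module Y = Groupoid Y
  field
    F₀ : X.Obj → Y.Obj
    F₁ : ∀ {a b} → X.Hom a b → Y.Hom (F₀ a) (F₀ b)
    F-resp : ∀ {a b} {f g : X.Hom a b} → f X.≈ g → F₁ f Y.≈ F₁ g
    F-id : ∀ {a} → F₁ (X.id {a}) Y.≈ Y.id
    F-∘ : ∀ {a b c} {f : X.Hom a b} {g : X.Hom b c} →
          F₁ (g X.∘ f) Y.≈ F₁ g Y.∘ F₁ f

open Functor public

record NatTrans {X Y : Groupoid} (F G : Functor X Y) : Set where
  private
    module X = Groupoid X
    module Y = Groupoid Y
  field
    η : ∀ x → Y.Hom (F₀ F x) (F₀ G x)
    natural : ∀ {x y} (f : X.Hom x y) → η y Y.∘ F₁ F f Y.≈ F₁ G f Y.∘ η x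

open NatTrans public

_≈ⁿ_ : ∀ {X Y} {F G : Functor X Y} → NatTrans F G → NatTrans F G → Set
_≈ⁿ_ {X} {Y} θ θ' = ∀ x → Groupoid._≈_ Y (η θ x) (η θ' x)

idF : ∀ {X} → Functor X X
idF {X} = record
  { F₀ = λ x → x ; F₁ = λ f → f ; F-resp = λ p → p
  ; F-id = Groupoid.≈.refl X ; F-∘ = Groupoid.≈.refl X }

infixr 9 _∘F_
_∘F_ : ∀ {X Y Z} → Functor Y Z → Functor X Y → Functor X Z
_∘F_ {X} {Y} {Z} G F = record
  { F₀ = λ x → F₀ G (F₀ F x)
  ; F₁ = λ f → F₁ G (F₁ F f)
  ; F-resp = λ p → F-resp G (F-resp F p)
  ; F-id = Z.≈.trans (F-resp G (F-id F)) (F-id G)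
  ; F-∘ = Z.≈.trans (F-resp G (F-∘ F)) (F-∘ G) }
  where module Z = Groupoid Z

module Lemmas (G : Groupoid) where
  open Groupoid G
  open SetoidR

  swap : ∀ {a b c d : Groupoid.Obj G} {a' : Hom c d} {x : Hom a c} {y : Hom b d} {b' : Hom a b} →
         a' ∘ x ≈ y ∘ b' → a' ⁻¹ ∘ y ≈ x ∘ b' ⁻¹
  swap {a' = a'} {x} {y} {b'} eq = begin⟨ homSetoid _ _ ⟩
    a' ⁻¹ ∘ y                      ≈⟨ ≈.sym identityʳ ⟩
    (a' ⁻¹ ∘ y) ∘ id               ≈⟨ ∘-resp-≈ ≈.refl (≈.sym inverseʳ) ⟩
    (a' ⁻¹ ∘ y) ∘ (b' ∘ b' ⁻¹)      ≈⟨ assoc ⟩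
    a' ⁻¹ ∘ (y ∘ (b' ∘ b' ⁻¹))      ≈⟨ ∘-resp-≈ ≈.refl (≈.sym assoc) ⟩
    a' ⁻¹ ∘ ((y ∘ b') ∘ b' ⁻¹)      ≈⟨ ∘-resp-≈ ≈.refl (∘-resp-≈ (≈.sym eq) ≈.refl) ⟩
    a' ⁻¹ ∘ ((a' ∘ x) ∘ b' ⁻¹)      ≈⟨ ∘-resp-≈ ≈.refl assoc ⟩
    a' ⁻¹ ∘ (a' ∘ (x ∘ b' ⁻¹))      ≈⟨ ≈.sym assoc ⟩
    (a' ⁻¹ ∘ a') ∘ (x ∘ b' ⁻¹)      ≈⟨ ∘-resp-≈ inverseˡ ≈.refl ⟩
    id ∘ (x ∘ b' ⁻¹)               ≈⟨ identityˡ ⟩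
    x ∘ b' ⁻¹                      ∎

module FLemmas {X Y : Groupoid} (F : Functor X Y) where
  private
    module X = Groupoid X
  open Groupoid Y
  open SetoidR

  F-inv : ∀ {a b} {f : X.Hom a b} → F₁ F (f X.⁻¹) ≈ (F₁ F f) ⁻¹
  F-inv {f = f} = begin⟨ homSetoid _ _ ⟩
    F₁ F (f X.⁻¹)                              ≈⟨ ≈.sym identityʳ ⟩
    F₁ F (f X.⁻¹) ∘ id                         ≈⟨ ∘-resp-≈ ≈.refl (≈.sym inverseʳ) ⟩
    F₁ F (f X.⁻¹) ∘ (F₁ F f ∘ (F₁ F f) ⁻¹)      ≈⟨ ≈.sym assoc ⟩
    (F₁ F (f X.⁻¹) ∘ F₁ F f) ∘ (F₁ F f) ⁻¹      ≈⟨ ∘-resp-≈ (≈.sym (F-∘ F)) ≈.refl ⟩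
    F₁ F (f X.⁻¹ X.∘ f) ∘ (F₁ F f) ⁻¹          ≈⟨ ∘-resp-≈ (F-resp F X.inverseˡ) ≈.refl ⟩
    F₁ F X.id ∘ (F₁ F f) ⁻¹                    ≈⟨ ∘-resp-≈ (F-id F) ≈.refl ⟩
    id ∘ (F₁ F f) ⁻¹                           ≈⟨ identityˡ ⟩
    (F₁ F f) ⁻¹                                ∎

infixr 2 _×G_
_×G_ : Groupoid → Groupoid → Groupoid
A ×G B = record
  { Obj = A.Obj × B.Obj
  ; Hom = λ x y → A.Hom (proj₁ x) (proj₁ y) × B.Hom (proj₂ x) (proj₂ y)
  ; _≈_ = λ f g → (proj₁ f A.≈ proj₁ g) × (proj₂ f B.≈ proj₂ g)
  ; ≈-equiv = record
      { refl = A.≈.refl , B.≈.refl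
      ; sym = λ (p , q) → A.≈.sym p , B.≈.sym q
      ; trans = λ (p , q) (p' , q') → A.≈.trans p p' , B.≈.trans q q' }
  ; id = A.id , B.id
  ; _∘_ = λ (g , g') (f , f') → (g A.∘ f) , (g' B.∘ f')
  ; _⁻¹ = λ (f , f') → (f A.⁻¹) , (f' B.⁻¹)
  ; assoc = A.assoc , B.assoc
  ; identityˡ = A.identityˡ , B.identityˡ
  ; identityʳ = A.identityʳ , B.identityʳ
  ; inverseˡ = A.inverseˡ , B.inverseˡ
  ; inverseʳ = A.inverseʳ , B.inverseʳ
  ; ∘-resp-≈ = λ (p , p') (q , q') → A.∘-resp-≈ p q , B.∘-resp-≈ p' q' }
  where
    module A = Groupoid A
    module B = Groupoid B

π₁ : ∀ {A B} → Functor (A ×G B) A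
π₁ {A} = record
  { F₀ = proj₁ ; F₁ = proj₁ ; F-resp = proj₁
  ; F-id = Groupoid.≈.refl A ; F-∘ = Groupoid.≈.refl A }

π₂ : ∀ {A B} → Functor (A ×G B) B
π₂ {B = B} = record
  { F₀ = proj₂ ; F₁ = proj₂ ; F-resp = proj₂
  ; F-id = Groupoid.≈.refl B ; F-∘ = Groupoid.≈.refl B }

_×F_ : ∀ {X Y A B} → Functor X A → Functor Y B → Functor (X ×G Y) (A ×G B)
F ×F G = record
  { F₀ = λ (x , y) → F₀ F x , F₀ G y
  ; F₁ = λ (f , g) → F₁ F f , F₁ G g
  ; F-resp = λ (p , q) → F-resp F p , F-resp G q
  ; F-id = F-id F , F-id G
  ; F-∘ = F-∘ F , F-∘ G }

module Pullback {S T B : Groupoid} (u : Functor S B) (v : Functor T B) where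
  private
    module S = Groupoid S
    module T = Groupoid T
    module B = Groupoid B
  open SetoidR

  record PObj : Set where
    constructor pobj
    field
      s : S.Obj
      t : T.Obj
      p : F₀ u s ≡ F₀ v t
  open PObj public

  record PHom (x y : PObj) : Set where
    constructor phom
    field
      f : S.Hom (s x) (s y)
      g : T.Hom (t x) (t y)
      comm : F₁ v g B.∘ B.τ (p x) B.≈ B.τ (p y) B.∘ F₁ u f
  open PHom public

  private
    pid : ∀ {x} → PHom x x
    pid {x} = phom S.id T.id (begin⟨ B.homSetoid _ _ ⟩
      F₁ v T.id B.∘ B.τ (p x)   ≈⟨ B.∘-resp-≈ (F-id v) B.≈.refl ⟩
      B.id B.∘ B.τ (p x)        ≈⟨ B.identityˡ ⟩
      B.τ (p x)                 ≈⟨ B.≈.sym B.identityʳ ⟩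
      B.τ (p x) B.∘ B.id        ≈⟨ B.∘-resp-≈ B.≈.refl (B.≈.sym (F-id u)) ⟩
      B.τ (p x) B.∘ F₁ u S.id   ∎)

    pcomp : ∀ {x y z} → PHom y z → PHom x y → PHom x z
    pcomp {x} {y} {z} (phom f' g' c') (phom f g c) = phom (f' S.∘ f) (g' T.∘ g) (begin⟨ B.homSetoid _ _ ⟩
      F₁ v (g' T.∘ g) B.∘ B.τ (p x)              ≈⟨ B.∘-resp-≈ (F-∘ v) B.≈.refl ⟩
      (F₁ v g' B.∘ F₁ v g) B.∘ B.τ (p x)         ≈⟨ B.assoc ⟩
      F₁ v g' B.∘ (F₁ v g B.∘ B.τ (p x))         ≈⟨ B.∘-resp-≈ B.≈.refl c ⟩
      F₁ v g' B.∘ (B.τ (p y) B.∘ F₁ u f)         ≈⟨ B.≈.sym B.assoc ⟩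
      (F₁ v g' B.∘ B.τ (p y)) B.∘ F₁ u f         ≈⟨ B.∘-resp-≈ c' B.≈.refl ⟩
      (B.τ (p z) B.∘ F₁ u f') B.∘ F₁ u f         ≈⟨ B.assoc ⟩
      B.τ (p z) B.∘ (F₁ u f' B.∘ F₁ u f)         ≈⟨ B.∘-resp-≈ B.≈.refl (B.≈.sym (F-∘ u)) ⟩
      B.τ (p z) B.∘ F₁ u (f' S.∘ f)              ∎)

    pinv : ∀ {x y} → PHom x y → PHom y x
    pinv {x} {y} (phom f g c) = phom (f S.⁻¹) (g T.⁻¹) (begin⟨ B.homSetoid _ _ ⟩
      F₁ v (g T.⁻¹) B.∘ B.τ (p y)         ≈⟨ B.∘-resp-≈ (FLemmas.F-inv v) B.≈.refl ⟩
      (F₁ v g) B.⁻¹ B.∘ B.τ (p y)         ≈⟨ Lemmas.swap B {F₀ u (s x)} {F₀ u (s y)} {F₀ v (t x)} {F₀ v (t y)} c ⟩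
      B.τ (p x) B.∘ (F₁ u f) B.⁻¹         ≈⟨ B.∘-resp-≈ B.≈.refl (B.≈.sym (FLemmas.F-inv u)) ⟩
      B.τ (p x) B.∘ F₁ u (f S.⁻¹)         ∎)

  P : Groupoid
  P = record
    { Obj = PObj
    ; Hom = PHom
    ; _≈_ = λ h h' → (f h S.≈ f h') × (g h T.≈ g h')
    ; ≈-equiv = record
        { refl = S.≈.refl , T.≈.refl
        ; sym = λ (a , b) → S.≈.sym a , T.≈.sym b
        ; trans = λ (a , b) (a' , b') → S.≈.trans a a' , T.≈.trans b b' }
    ; id = pid
    ; _∘_ = pcomp
    ; _⁻¹ = pinv
    ; assoc = S.assoc , T.assoc
    ; identityˡ = S.identityˡ , T.identityˡ
    ; identityʳ = S.identityʳ , T.identityʳ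
    ; inverseˡ = S.inverseˡ , T.inverseˡ
    ; inverseʳ = S.inverseʳ , T.inverseʳ
    ; ∘-resp-≈ = λ (a , b) (a' , b') → S.∘-resp-≈ a a' , T.∘-resp-≈ b b' }

  l : Functor P S
  l = record { F₀ = s ; F₁ = f ; F-resp = proj₁ ; F-id = S.≈.refl ; F-∘ = S.≈.refl }

  r : Functor P T
  r = record { F₀ = t ; F₁ = g ; F-resp = proj₂ ; F-id = T.≈.refl ; F-∘ = T.≈.refl }

module Cospan {S T B : Groupoid} (u : Functor S B) (v : Functor T B) where
  private
    module S = Groupoid S
    module T = Groupoid T
    module B = Groupoid B

  record PsCone (X : Groupoid) : Set where
    private module X = Groupoid X
    field
      l' : Functor X S
      r' : Functor X T
      ν : ∀ x → B.Hom (F₀ u (F₀ l' x)) (F₀ v (F₀ r' x))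
      ν-nat : ∀ {x y} (f : X.Hom x y) →
              ν y B.∘ F₁ u (F₁ l' f) B.≈ F₁ v (F₁ r' f) B.∘ ν x
  open PsCone public

  record ConeMor {X : Groupoid} (c c'' : PsCone X) : Set where
    field
      α : NatTrans (l' c) (l' c'')
      β : NatTrans (r' c) (r' c'')
      comm : ∀ x → ν c'' x B.∘ F₁ u (η α x) B.≈ F₁ v (η β x) B.∘ ν c x
  open ConeMor public

  _≈c_ : ∀ {X} {c c'' : PsCone X} → ConeMor c c'' → ConeMor c c'' → Set
  m ≈c m' = (α m ≈ⁿ α m') × (β m ≈ⁿ β m')

  -- isomorphisms in the category of pseudocones with vertex X
  -- (composition and identities there are componentwise)
  record ConeIso {X : Groupoid} (c c'' : PsCone X) : Set where
    field
      to : ConeMor c c''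
      from : ConeMor c'' c
      α-invˡ : ∀ x → η (α from) x S.∘ η (α to) x S.≈ S.id
      α-invʳ : ∀ x → η (α to) x S.∘ η (α from) x S.≈ S.id
      β-invˡ : ∀ x → η (β from) x T.∘ η (β to) x T.≈ T.id
      β-invʳ : ∀ x → η (β to) x T.∘ η (β from) x T.≈ T.id

  module Comparison {P : Groupoid} (c : PsCone P) where
    private module P = Groupoid P
    open SetoidR

    onObj : ∀ {X} → Functor X P → PsCone X
    onObj h = record
      { l' = l' c ∘F h
      ; r' = r' c ∘F h
      ; ν = λ x → ν c (F₀ h x)
      ; ν-nat = λ f → ν-nat c (F₁ h f) }

    whisker : ∀ {X Y} (F : Functor P Y) {h h' : Functor X P} →
              NatTrans h h' → NatTrans (F ∘F h) (F ∘F h')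
    whisker {Y = Y} F {h} {h'} θ = record
      { η = λ x → F₁ F (η θ x)
      ; natural = λ {x} {y} f → begin⟨ Y.homSetoid _ _ ⟩
          F₁ F (η θ y) Y.∘ F₁ F (F₁ h f)    ≈⟨ Y.≈.sym (F-∘ F) ⟩
          F₁ F (η θ y P.∘ F₁ h f)          ≈⟨ F-resp F (natural θ f) ⟩
          F₁ F (F₁ h' f P.∘ η θ x)         ≈⟨ F-∘ F ⟩
          F₁ F (F₁ h' f) Y.∘ F₁ F (η θ x)   ∎ }
      where module Y = Groupoid Y

    onMor : ∀ {X} {h h' : Functor X P} → NatTrans h h' → ConeMor (onObj h) (onObj h')
    onMor θ = record
      { α = whisker (l' c) θ
      ; β = whisker (r' c) θ
      ; comm = λ x → ν-nat c (η θ x) }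

  record IsEquivalenceAt {P : Groupoid} (c : PsCone P) (X : Groupoid) : Set where
    open Comparison c
    field
      full : ∀ {h h' : Functor X P} (m : ConeMor (onObj h) (onObj h')) →
             Σ[ θ ∈ NatTrans h h' ] (onMor θ ≈c m)
      faithful : ∀ {h h' : Functor X P} (θ θ' : NatTrans h h') →
                 onMor θ ≈c onMor θ' → θ ≈ⁿ θ'
      essSurj : ∀ (c' : PsCone X) → Σ[ h ∈ Functor X P ] ConeIso (onObj h) c'

  IsBipullback : {P : Groupoid} → PsCone P → Set₁
  IsBipullback c = ∀ (X : Groupoid) → IsEquivalenceAt c X

  pullbackCone : PsCone (Pullback.P u v)
  pullbackCone = record
    { l' = Pullback.l u v
    ; r' = Pullback.r u v
    ; ν = λ x → B.τ (Pullback.p x)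
    ; ν-nat = λ h → B.≈.sym (Pullback.comm h) }

record Prestrat (A : Groupoid) : Set₁ where
  constructor prestrat
  field
    G : Groupoid
    ∂ : Functor G A
open Prestrat public

_⊥_ : ∀ {A} → Prestrat A → Prestrat A → Set₁
S ⊥ T = Cospan.IsBipullback (∂ S) (∂ T) (Cospan.pullbackCone (∂ S) (∂ T))

Class : Groupoid → Set₂
Class A = Prestrat A → Set₁

_⊆_ : ∀ {A} → Class A → Class A → Set₁
C ⊆ D = ∀ W → C W → D W

_≐_ : ∀ {A} → Class A → Class A → Set₁
C ≐ D = (C ⊆ D) × (D ⊆ C)

_^⊥ : ∀ {A} → Class A → Class A
(C ^⊥) T = ∀ S → C S → S ⊥ T

record UGpd : Set₂ where
  field
    grp : Groupoid
    U : Class grp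
    closed : ((U ^⊥) ^⊥) ≐ U
open UGpd public

idPre : (A : Groupoid) → Prestrat A
idPre A = prestrat A idF

_×P_ : ∀ {A B} → Prestrat A → Prestrat B → Prestrat (A ×G B)
S ×P U = prestrat (G S ×G G U) (∂ S ×F ∂ U)

U⊸ : (A B : UGpd) → Class (grp A ×G grp B)
U⊸ A B = (λ W → Σ[ S ∈ Prestrat (grp A) ] Σ[ V ∈ Prestrat (grp B) ]
                  (U A S × (U B ^⊥) V × (W ≡ (S ×P V)))) ^⊥

∂A : ∀ {A B} → (T : Prestrat (A ×G B)) → Functor (G T) A
∂A T = π₁ ∘F ∂ T

∂B : ∀ {A B} → (T : Prestrat (A ×G B)) → Functor (G T) B
∂B T = π₂ ∘F ∂ T

restrictA : ∀ {A B} → Prestrat (A ×G B) → Prestrat A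
restrictA T = prestrat (G T) (∂A T)

_＠_ : ∀ {A B} → Prestrat (A ×G B) → Prestrat A → Prestrat B
T ＠ S = prestrat (Pullback.P (∂ S) (∂A T)) (∂B T ∘F Pullback.r (∂ S) (∂A T))

{-# OPTIONS --safe #-}
module Submission where

-- Uniform orthogonality S ⊥ T is a lifting property: the comparison functor of a strict pullback of
-- groupoids is always full and faithful, so S ⊥ T says exactly that every morphism
-- ∂S s → ∂T t is carried by morphisms s → s′ in S and t → t′ in T onto an identity ∂S s′ = ∂T t′.
-- With lifts in hand both directions are diagram chases.  A lift of φ against T restricts along the
-- product S × V to lifts against T @ S and (taking V = id_B, orthogonal to everything) against ∂^T_A.
-- Conversely a lift of S × V against T is assembled from a lift of V against ∂^T_B (obtained from
-- T @ id_A ∈ U_B) and a lift of S against T applied to V in the other direction; the latter is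
-- orthogonal to every S′ ∈ 𝕊, hence to U_A = 𝕊^⊥⊥.

open import Defs
open import Data.Product using (_×_; _,_; proj₁; proj₂)
open import Data.Unit using (⊤; tt)
open import Relation.Binary.PropositionalEquality using (_≡_; refl; cong; cong₂; sym)
import Relation.Binary.Reasoning.MultiSetoid as SetoidR

module GroupoidProperties (G : Groupoid) where
  open Groupoid G
  open SetoidR

  glue : ∀ {o₁ o₂ o₃ o₄ o₅ o₆} {x : Hom o₁ o₂} {a : Hom o₂ o₃} {b : Hom o₁ o₄} {y : Hom o₄ o₃}
           {c : Hom o₃ o₆} {d : Hom o₄ o₅} {z : Hom o₅ o₆} →
         a ∘ x ≈ y ∘ b → c ∘ y ≈ z ∘ d → (c ∘ a) ∘ x ≈ z ∘ (d ∘ b)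
  glue {x = x} {a} {b} {y} {c} {d} {z} sq₁ sq₂ = begin⟨ homSetoid _ _ ⟩
    (c ∘ a) ∘ x  ≈⟨ assoc ⟩
    c ∘ (a ∘ x)  ≈⟨ ∘-resp-≈ ≈.refl sq₁ ⟩
    c ∘ (y ∘ b)  ≈⟨ ≈.sym assoc ⟩
    (c ∘ y) ∘ b  ≈⟨ ∘-resp-≈ sq₂ ≈.refl ⟩
    (z ∘ d) ∘ b  ≈⟨ assoc ⟩
    z ∘ (d ∘ b)  ∎

  id⁻¹≈id : ∀ {o} → id {o} ⁻¹ ≈ id
  id⁻¹≈id = ≈.trans (≈.sym identityˡ) inverseʳ

  ⁻¹-involutive : ∀ {o₁ o₂} {f : Hom o₁ o₂} → (f ⁻¹) ⁻¹ ≈ f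
  ⁻¹-involutive {f = f} = begin⟨ homSetoid _ _ ⟩
    (f ⁻¹) ⁻¹               ≈⟨ ≈.sym identityʳ ⟩
    (f ⁻¹) ⁻¹ ∘ id          ≈⟨ ∘-resp-≈ ≈.refl (≈.sym inverseˡ) ⟩
    (f ⁻¹) ⁻¹ ∘ (f ⁻¹ ∘ f)  ≈⟨ ≈.sym assoc ⟩
    ((f ⁻¹) ⁻¹ ∘ f ⁻¹) ∘ f  ≈⟨ ∘-resp-≈ inverseˡ ≈.refl ⟩
    id ∘ f                  ≈⟨ identityˡ ⟩
    f                       ∎

  τ-sym : ∀ {o₁ o₂} (p : o₁ ≡ o₂) → τ (sym p) ≈ τ p ⁻¹
  τ-sym refl = ≈.sym id⁻¹≈id

  cancelˡ : ∀ {o₁ o₂ o₃} {a : Hom o₂ o₃} {k : Hom o₁ o₂} → a ⁻¹ ∘ (a ∘ k) ≈ k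
  cancelˡ = ≈.trans (≈.sym assoc) (≈.trans (∘-resp-≈ inverseˡ ≈.refl) identityˡ)

  cancelʳ : ∀ {o₁ o₂ o₃} {b : Hom o₁ o₂} {k : Hom o₁ o₃} → (k ∘ b ⁻¹) ∘ b ≈ k
  cancelʳ = ≈.trans assoc (≈.trans (∘-resp-≈ ≈.refl inverseˡ) identityʳ)

module FunctorProperties {X Y : Groupoid} (F : Functor X Y) where
  private
    module X = Groupoid X
  open Groupoid Y

  F-∘₃ : ∀ {a b c d} {f : X.Hom a b} {g : X.Hom b c} {h : X.Hom c d} →
         F₁ F (h X.∘ (g X.∘ f)) ≈ F₁ F h ∘ (F₁ F g ∘ F₁ F f)
  F-∘₃ = ≈.trans (F-∘ F) (∘-resp-≈ ≈.refl (F-∘ F))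

module _ {X Y G : Groupoid} (D : Functor X G) (E : Functor Y G) where
  private
    module X = Groupoid X
    module Y = Groupoid Y
  open Groupoid G
  open SetoidR

  glue-F₁ : ∀ {x₁ x₂ x₃ y₁ y₂ y₃} {g₁ : X.Hom x₁ x₂} {g₂ : X.Hom x₂ x₃} {f₁ : Y.Hom y₁ y₂}
              {f₂ : Y.Hom y₂ y₃} {φ : Hom (F₀ E y₁) (F₀ D x₁)} {ψ : Hom (F₀ E y₂) (F₀ D x₂)}
              {χ : Hom (F₀ E y₃) (F₀ D x₃)} →
            F₁ D g₁ ∘ φ ≈ ψ ∘ F₁ E f₁ → F₁ D g₂ ∘ ψ ≈ χ ∘ F₁ E f₂ →
            F₁ D (g₂ X.∘ g₁) ∘ φ ≈ χ ∘ F₁ E (f₂ Y.∘ f₁)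
  glue-F₁ {g₁ = g₁} {g₂} {f₁} {f₂} {φ} {ψ} {χ} sq₁ sq₂ = begin⟨ homSetoid _ _ ⟩
    F₁ D (g₂ X.∘ g₁) ∘ φ     ≈⟨ ∘-resp-≈ (F-∘ D) ≈.refl ⟩
    (F₁ D g₂ ∘ F₁ D g₁) ∘ φ  ≈⟨ GroupoidProperties.glue G sq₁ sq₂ ⟩
    χ ∘ (F₁ E f₂ ∘ F₁ E f₁)  ≈⟨ ∘-resp-≈ ≈.refl (≈.sym (F-∘ E)) ⟩
    χ ∘ F₁ E (f₂ Y.∘ f₁)     ∎

module Conjugate {X Y : Groupoid} (F : Functor X Y) (o : Groupoid.Obj X → Groupoid.Obj Y)
                 (b : ∀ x → Groupoid.Hom Y (F₀ F x) (o x)) where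
  private
    module X = Groupoid X
  open Groupoid Y
  open GroupoidProperties Y
  open SetoidR

  conjugate : Functor X Y
  conjugate = record
    { F₀ = o
    ; F₁ = λ {x} {y} f → b y ∘ (F₁ F f ∘ b x ⁻¹)
    ; F-resp = λ e → ∘-resp-≈ ≈.refl (∘-resp-≈ (F-resp F e) ≈.refl)
    ; F-id = ≈.trans (∘-resp-≈ ≈.refl (≈.trans (∘-resp-≈ (F-id F) ≈.refl) identityˡ)) inverseʳ
    ; F-∘ = λ {x} {y} {z} {f} {g} → begin⟨ homSetoid _ _ ⟩
        b z ∘ (F₁ F (g X.∘ f) ∘ b x ⁻¹)                   ≈⟨ ∘-resp-≈ ≈.refl (∘-resp-≈ (F-∘ F) ≈.refl) ⟩
        b z ∘ ((F₁ F g ∘ F₁ F f) ∘ b x ⁻¹)                ≈⟨ ∘-resp-≈ ≈.refl assoc ⟩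
        b z ∘ (F₁ F g ∘ (F₁ F f ∘ b x ⁻¹))                ≈⟨ ∘-resp-≈ ≈.refl (∘-resp-≈ ≈.refl (≈.sym cancelˡ)) ⟩
        b z ∘ (F₁ F g ∘ (b y ⁻¹ ∘ (b y ∘ (F₁ F f ∘ b x ⁻¹)))) ≈⟨ ∘-resp-≈ ≈.refl (≈.sym assoc) ⟩
        b z ∘ ((F₁ F g ∘ b y ⁻¹) ∘ (b y ∘ (F₁ F f ∘ b x ⁻¹))) ≈⟨ ≈.sym assoc ⟩
        (b z ∘ (F₁ F g ∘ b y ⁻¹)) ∘ (b y ∘ (F₁ F f ∘ b x ⁻¹)) ∎ }

  to-conjugate : NatTrans F conjugate
  to-conjugate = record { η = b ; natural = λ f → ≈.sym (≈.trans assoc (∘-resp-≈ ≈.refl cancelʳ)) }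

  from-conjugate : NatTrans conjugate F
  from-conjugate = record { η = λ x → b x ⁻¹ ; natural = λ f → cancelˡ }

record Lift {A : Groupoid} (S T : Prestrat A) (s : Groupoid.Obj (G S)) (t : Groupoid.Obj (G T))
            (φ : Groupoid.Hom A (F₀ (∂ S) s) (F₀ (∂ T) t)) : Set where
  open Groupoid A using (_∘_; _≈_; τ)
  field
    s′ : Groupoid.Obj (G S)
    t′ : Groupoid.Obj (G T)
    meet : F₀ (∂ S) s′ ≡ F₀ (∂ T) t′
    α : Groupoid.Hom (G S) s s′
    β : Groupoid.Hom (G T) t t′
    square : τ meet ∘ F₁ (∂ S) α ≈ F₁ (∂ T) β ∘ φ

Liftable : ∀ {A} → Prestrat A → Prestrat A → Set
Liftable {A} S T = ∀ s t φ → Lift {A} S T s t φ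

𝟙 : Groupoid
𝟙 = record
  { Obj = ⊤ ; Hom = λ _ _ → ⊤ ; _≈_ = λ _ _ → ⊤
  ; ≈-equiv = record { refl = tt ; sym = λ _ → tt ; trans = λ _ _ → tt }
  ; id = tt ; _∘_ = λ _ _ → tt ; _⁻¹ = λ _ → tt
  ; assoc = tt ; identityˡ = tt ; identityʳ = tt ; inverseˡ = tt ; inverseʳ = tt
  ; ∘-resp-≈ = λ _ _ → tt }

const : ∀ {Y : Groupoid} → Groupoid.Obj Y → Functor 𝟙 Y
const {Y} y = record
  { F₀ = λ _ → y ; F₁ = λ _ → id ; F-resp = λ _ → ≈.refl ; F-id = ≈.refl
  ; F-∘ = ≈.sym identityˡ }
  where open Groupoid Y

module Orthogonality {A : Groupoid} (S T : Prestrat A) where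
  private
    module A = Groupoid A
    module S = Groupoid (G S)
    module T = Groupoid (G T)
    module PB = Pullback (∂ S) (∂ T)
  open Cospan (∂ S) (∂ T)
  open SetoidR

  ⊥⇒Liftable : S ⊥ T → Liftable S T
  ⊥⇒Liftable bipullback s t φ = record
    { s′ = PB.s (F₀ h tt) ; t′ = PB.t (F₀ h tt) ; meet = PB.p (F₀ h tt)
    ; α = η (α (ConeIso.from iso)) tt ; β = η (β (ConeIso.from iso)) tt
    ; square = ConeMor.comm (ConeIso.from iso) tt }
    where
      φ-cone : PsCone 𝟙
      φ-cone = record
        { l' = const s ; r' = const t ; ν = λ _ → φ
        ; ν-nat = λ _ → begin⟨ A.homSetoid _ _ ⟩
            φ A.∘ F₁ (∂ S) S.id  ≈⟨ A.∘-resp-≈ A.≈.refl (F-id (∂ S)) ⟩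
            φ A.∘ A.id           ≈⟨ A.identityʳ ⟩
            φ                    ≈⟨ A.≈.sym A.identityˡ ⟩
            A.id A.∘ φ           ≈⟨ A.∘-resp-≈ (A.≈.sym (F-id (∂ T))) A.≈.refl ⟩
            F₁ (∂ T) T.id A.∘ φ  ∎ }
      h = proj₁ (IsEquivalenceAt.essSurj (bipullback 𝟙) φ-cone)
      iso = proj₂ (IsEquivalenceAt.essSurj (bipullback 𝟙) φ-cone)

  Liftable⇒⊥ : Liftable S T → S ⊥ T
  Liftable⇒⊥ lift X = record
    { full = λ m → full m , (λ _ → S.≈.refl) , (λ _ → T.≈.refl)
    ; faithful = λ θ θ' (eq₁ , eq₂) x → eq₁ x , eq₂ x
    ; essSurj = λ c → lifted-functor c , lifted-iso c }
    where
      module X = Groupoid X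
      open Comparison pullbackCone

      full : ∀ {h h' : Functor X PB.P} → ConeMor (onObj h) (onObj h') → NatTrans h h'
      full m = record
        { η = λ x → PB.phom (η (α m) x) (η (β m) x) (A.≈.sym (ConeMor.comm m x))
        ; natural = λ f → natural (α m) f , natural (β m) f }

      module _ (c : PsCone X) where
        module R (x : X.Obj) = Lift (lift _ _ (ν c x))
        open Conjugate (l' c) R.s′ R.α renaming
          (conjugate to l″; to-conjugate to l'⇒l″; from-conjugate to l″⇒l')
        open Conjugate (r' c) R.t′ R.β renaming
          (conjugate to r″; to-conjugate to r'⇒r″; from-conjugate to r″⇒r')

        square⁻¹ : ∀ x → F₁ (∂ T) (R.β x T.⁻¹) A.∘ A.τ (R.meet x)
                         A.≈ ν c x A.∘ F₁ (∂ S) (R.α x S.⁻¹)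
        square⁻¹ x = begin⟨ A.homSetoid _ _ ⟩
          F₁ (∂ T) (R.β x T.⁻¹) A.∘ A.τ (R.meet x)  ≈⟨ A.∘-resp-≈ (FLemmas.F-inv (∂ T)) A.≈.refl ⟩
          F₁ (∂ T) (R.β x) A.⁻¹ A.∘ A.τ (R.meet x)  ≈⟨ Lemmas.swap A (A.≈.sym (R.square x)) ⟩
          ν c x A.∘ F₁ (∂ S) (R.α x) A.⁻¹           ≈⟨ A.∘-resp-≈ A.≈.refl (A.≈.sym (FLemmas.F-inv (∂ S))) ⟩
          ν c x A.∘ F₁ (∂ S) (R.α x S.⁻¹)           ∎

        lifted-square : ∀ {x y} (f : X.Hom x y) →
          F₁ (∂ T) (F₁ r″ f) A.∘ A.τ (R.meet x) A.≈ A.τ (R.meet y) A.∘ F₁ (∂ S) (F₁ l″ f)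
        lifted-square {x} {y} f = begin⟨ A.homSetoid _ _ ⟩
          F₁ (∂ T) (F₁ r″ f) A.∘ A.τ (R.meet x)
            ≈⟨ A.∘-resp-≈ (FunctorProperties.F-∘₃ (∂ T)) A.≈.refl ⟩
          (F₁ (∂ T) (R.β y) A.∘ (F₁ (∂ T) (F₁ (r' c) f) A.∘ F₁ (∂ T) (R.β x T.⁻¹))) A.∘ A.τ (R.meet x)
            ≈⟨ glue (glue (square⁻¹ x) (A.≈.sym (ν-nat c f))) (A.≈.sym (R.square y)) ⟩
          A.τ (R.meet y) A.∘ (F₁ (∂ S) (R.α y) A.∘ (F₁ (∂ S) (F₁ (l' c) f) A.∘ F₁ (∂ S) (R.α x S.⁻¹)))
            ≈⟨ A.∘-resp-≈ A.≈.refl (A.≈.sym (FunctorProperties.F-∘₃ (∂ S))) ⟩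
          A.τ (R.meet y) A.∘ F₁ (∂ S) (F₁ l″ f) ∎
          where open GroupoidProperties A

        lifted-functor : Functor X PB.P
        lifted-functor = record
          { F₀ = λ x → PB.pobj _ _ (R.meet x)
          ; F₁ = λ f → PB.phom (F₁ l″ f) (F₁ r″ f) (lifted-square f)
          ; F-resp = λ e → F-resp l″ e , F-resp r″ e
          ; F-id = F-id l″ , F-id r″
          ; F-∘ = F-∘ l″ , F-∘ r″ }

        -- The transformations are rebuilt from their components because Pullback.l ∘F lifted-functor
        -- agrees with l″ on objects and morphisms but not in its proof fields.
        lifted-iso : ConeIso (onObj lifted-functor) c
        lifted-iso = record
          { to = record
              { α = record { η = η l″⇒l' ; natural = natural l″⇒l' }
              ; β = record { η = η r″⇒r' ; natural = natural r″⇒r' }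
              ; comm = λ x → A.≈.sym (square⁻¹ x) }
          ; from = record
              { α = record { η = η l'⇒l″ ; natural = natural l'⇒l″ }
              ; β = record { η = η r'⇒r″ ; natural = natural r'⇒r″ }
              ; comm = R.square }
          ; α-invˡ = λ _ → S.inverseʳ
          ; α-invʳ = λ _ → S.inverseˡ
          ; β-invˡ = λ _ → T.inverseʳ
          ; β-invʳ = λ _ → T.inverseˡ }

⊥⇒Liftable : ∀ {A} {S T : Prestrat A} → S ⊥ T → Liftable S T
⊥⇒Liftable {S = S} {T} = Orthogonality.⊥⇒Liftable S T

Liftable⇒⊥ : ∀ {A} {S T : Prestrat A} → Liftable S T → S ⊥ T
Liftable⇒⊥ {S = S} {T} = Orthogonality.Liftable⇒⊥ S T

Liftable-sym : ∀ {A} {S T : Prestrat A} → Liftable S T → Liftable T S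
Liftable-sym {A} {S} {T} lift t s ψ = record
  { s′ = R.t′ ; t′ = R.s′ ; meet = sym R.meet ; α = R.β ; β = R.α
  ; square = begin⟨ homSetoid _ _ ⟩
      τ (sym R.meet) ∘ F₁ (∂ T) R.β  ≈⟨ ∘-resp-≈ (τ-sym R.meet) ≈.refl ⟩
      τ R.meet ⁻¹ ∘ F₁ (∂ T) R.β     ≈⟨ Lemmas.swap A R.square ⟩
      F₁ (∂ S) R.α ∘ (ψ ⁻¹) ⁻¹       ≈⟨ ∘-resp-≈ ≈.refl ⁻¹-involutive ⟩
      F₁ (∂ S) R.α ∘ ψ               ∎ }
  where
    open Groupoid A
    open GroupoidProperties A
    open SetoidR
    module R = Lift (lift s t (ψ ⁻¹))

Liftable-idPre : ∀ {A} {S : Prestrat A} → Liftable S (idPre A)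
Liftable-idPre {A} {S} s a φ = record
  { s′ = s ; t′ = F₀ (∂ S) s ; meet = refl ; α = Groupoid.id (G S) ; β = φ ⁻¹
  ; square = ≈.trans identityˡ (≈.trans (F-id (∂ S)) (≈.sym inverseˡ)) }
  where open Groupoid A

module ProductProperties (A B : Groupoid) where
  private
    module A = Groupoid A
    module B = Groupoid B
    module AB = Groupoid (A ×G B)

  τ-proj₁ : ∀ {x y : AB.Obj} (p : x ≡ y) → proj₁ (AB.τ p) A.≈ A.τ (cong proj₁ p)
  τ-proj₁ refl = A.≈.refl

  τ-proj₂ : ∀ {x y : AB.Obj} (p : x ≡ y) → proj₂ (AB.τ p) B.≈ B.τ (cong proj₂ p)
  τ-proj₂ refl = B.≈.refl

  τ-cong₂ : ∀ {a a' b b'} (p : a ≡ a') (q : b ≡ b') → AB.τ (cong₂ _,_ p q) AB.≈ (A.τ p , B.τ q)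
  τ-cong₂ refl refl = A.≈.refl , B.≈.refl

restrictB : ∀ {A B} → Prestrat (A ×G B) → Prestrat B
restrictB T = prestrat (G T) (∂B T)

-- T ＠ᵒᵖ V applies T, read as a prestrategy from B to A, to a prestrategy V on B.
_＠ᵒᵖ_ : ∀ {A B} → Prestrat (A ×G B) → Prestrat B → Prestrat A
T ＠ᵒᵖ V = prestrat (Pullback.P (∂ V) (∂B T)) (∂A T ∘F Pullback.r (∂ V) (∂B T))

module Transfer {A B : Groupoid} (T : Prestrat (A ×G B)) where
  private
    module A = Groupoid A
    module B = Groupoid B
    module T = Groupoid (G T)
  open ProductProperties A B
  open SetoidR

  module ProductLift {S : Prestrat A} {V : Prestrat B} {sv t φ} (R : Lift (S ×P V) T sv t φ) where
    open Lift R public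

    square₁ : A.τ (cong proj₁ meet) A.∘ F₁ (∂ S) (proj₁ α) A.≈ F₁ (∂A T) β A.∘ proj₁ φ
    square₁ = A.≈.trans (A.∘-resp-≈ (A.≈.sym (τ-proj₁ meet)) A.≈.refl) (proj₁ square)

    square₂ : B.τ (cong proj₂ meet) B.∘ F₁ (∂ V) (proj₂ α) B.≈ F₁ (∂B T) β B.∘ proj₂ φ
    square₂ = B.≈.trans (B.∘-resp-≈ (B.≈.sym (τ-proj₂ meet)) B.≈.refl) (proj₂ square)

  Liftable-restrictA : ∀ {S : Prestrat A} → Liftable (S ×P idPre B) T → Liftable S (restrictA T)
  Liftable-restrictA lift s t φ = record
    { s′ = proj₁ R.s′ ; t′ = R.t′ ; meet = cong proj₁ R.meet ; α = proj₁ R.α ; β = R.β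
    ; square = R.square₁ }
    where module R = ProductLift (lift (s , proj₂ (F₀ (∂ T) t)) t (φ , B.id))

  Liftable-＠ : ∀ {S : Prestrat A} {V : Prestrat B} → Liftable (S ×P V) T → Liftable V (T ＠ S)
  Liftable-＠ lift v (Pullback.pobj s t p) φ = record
    { s′ = proj₂ R.s′
    ; t′ = Pullback.pobj (proj₁ R.s′) R.t′ (cong proj₁ R.meet)
    ; meet = cong proj₂ R.meet
    ; α = proj₂ R.α
    ; β = Pullback.phom (proj₁ R.α) R.β (A.≈.sym R.square₁)
    ; square = R.square₂ }
    where module R = ProductLift (lift (s , v) t (A.τ p , φ))

  Liftable-restrictB : ∀ {V : Prestrat B} → Liftable V (T ＠ idPre A) → Liftable V (restrictB T)
  Liftable-restrictB lift v t φ = record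
    { s′ = R.s′ ; t′ = Pullback.t R.t′ ; meet = R.meet ; α = R.α ; β = Pullback.g R.β
    ; square = R.square }
    where module R = Lift (lift v (Pullback.pobj (proj₁ (F₀ (∂ T) t)) t refl) φ)

  -- A lift against S ×P V is built in two stages: first move the B-end with V, then the A-end with S.
  Liftable-×P : ∀ {S : Prestrat A} {V : Prestrat B} →
                Liftable V (restrictB T) → Liftable S (T ＠ᵒᵖ V) → Liftable (S ×P V) T
  Liftable-×P {S} {V} liftV liftS (s , v) t (φ₁ , φ₂) = record
    { s′ = R₂.s′ , P.s R₂.t′
    ; t′ = P.t R₂.t′
    ; meet = cong₂ _,_ R₂.meet (P.p R₂.t′)
    ; α = R₂.α , P.f R₂.β V.∘ R₁.α
    ; β = P.g R₂.β T.∘ R₁.β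
    ; square = AB.≈.trans (AB.∘-resp-≈ (τ-cong₂ R₂.meet (P.p R₂.t′)) AB.≈.refl) (square₁ , square₂) }
    where
      module V = Groupoid (G V)
      module AB = Groupoid (A ×G B)
      module P = Pullback (∂ V) (∂B T)
      module R₁ = Lift (liftV v t φ₂)
      module R₂ = Lift (liftS s (P.pobj R₁.s′ R₁.t′ R₁.meet) (F₁ (∂A T) R₁.β A.∘ φ₁))
      square₁ : A.τ R₂.meet A.∘ F₁ (∂ S) R₂.α A.≈ F₁ (∂A T) (P.g R₂.β T.∘ R₁.β) A.∘ φ₁
      square₁ = begin⟨ A.homSetoid _ _ ⟩
        A.τ R₂.meet A.∘ F₁ (∂ S) R₂.α                      ≈⟨ R₂.square ⟩
        F₁ (∂A T) (P.g R₂.β) A.∘ (F₁ (∂A T) R₁.β A.∘ φ₁)   ≈⟨ A.≈.sym A.assoc ⟩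
        (F₁ (∂A T) (P.g R₂.β) A.∘ F₁ (∂A T) R₁.β) A.∘ φ₁   ≈⟨ A.∘-resp-≈ (A.≈.sym (F-∘ (∂A T))) A.≈.refl ⟩
        F₁ (∂A T) (P.g R₂.β T.∘ R₁.β) A.∘ φ₁               ∎
      square₂ : B.τ (P.p R₂.t′) B.∘ F₁ (∂ V) (P.f R₂.β V.∘ R₁.α) B.≈ F₁ (∂B T) (P.g R₂.β T.∘ R₁.β) B.∘ φ₂
      square₂ = B.≈.sym (glue-F₁ (∂B T) (∂ V) (B.≈.sym R₁.square) (P.comm R₂.β))

  Liftable-＠ᵒᵖ : ∀ {S : Prestrat A} {V : Prestrat B} →
                  Liftable S (restrictA T) → Liftable V (T ＠ S) → Liftable S (T ＠ᵒᵖ V)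
  Liftable-＠ᵒᵖ {S} {V} liftA liftV s (Pullback.pobj v t q) φ = record
    { s′ = P.s R₂.t′
    ; t′ = Pullback.pobj R₂.s′ (P.t R₂.t′) R₂.meet
    ; meet = P.p R₂.t′
    ; α = P.f R₂.β S.∘ R₁.α
    ; β = Pullback.phom R₂.α (P.g R₂.β T.∘ R₁.β) squareB
    ; square = A.≈.sym (glue-F₁ (∂A T) (∂ S) (A.≈.sym R₁.square) (P.comm R₂.β)) }
    where
      module S = Groupoid (G S)
      module P = Pullback (∂ S) (∂A T)
      module R₁ = Lift (liftA s t φ)
      module R₂ = Lift (liftV v (P.pobj R₁.s′ R₁.t′ R₁.meet) (F₁ (∂B T) R₁.β B.∘ B.τ q))
      squareB : F₁ (∂B T) (P.g R₂.β T.∘ R₁.β) B.∘ B.τ q B.≈ B.τ R₂.meet B.∘ F₁ (∂ V) R₂.α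
      squareB = begin⟨ B.homSetoid _ _ ⟩
        F₁ (∂B T) (P.g R₂.β T.∘ R₁.β) B.∘ B.τ q               ≈⟨ B.∘-resp-≈ (F-∘ (∂B T)) B.≈.refl ⟩
        (F₁ (∂B T) (P.g R₂.β) B.∘ F₁ (∂B T) R₁.β) B.∘ B.τ q   ≈⟨ B.assoc ⟩
        F₁ (∂B T) (P.g R₂.β) B.∘ (F₁ (∂B T) R₁.β B.∘ B.τ q)   ≈⟨ B.≈.sym R₂.square ⟩
        B.τ R₂.meet B.∘ F₁ (∂ V) R₂.α                         ∎

proposition1 : (A B : UGpd) (T : Prestrat (grp A ×G grp B)) (𝕊 : Class (grp A)) →
    𝕊 ⊆ U A → 𝕊 (idPre (grp A)) → U A ≐ ((𝕊 ^⊥) ^⊥) →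
    (U⊸ A B T → ((∀ S → 𝕊 S → U B (T ＠ S)) × (U A ^⊥) (restrictA T)))
    × (((∀ S → 𝕊 S → U B (T ＠ S)) × (U A ^⊥) (restrictA T)) → U⊸ A B T)
proposition1 A B T 𝕊 𝕊⊆U id∈𝕊 (U⊆𝕊⊥⊥ , _) = necessary , sufficient
  where
    open Transfer T

    idPre∈U⊥ : (U B ^⊥) (idPre (grp B))
    idPre∈U⊥ _ _ = Liftable⇒⊥ Liftable-idPre

    necessary : U⊸ A B T → (∀ S → 𝕊 S → U B (T ＠ S)) × (U A ^⊥) (restrictA T)
    necessary T∈U⊸ =
        (λ S S∈𝕊 → proj₁ (closed B) (T ＠ S) λ V V∈U⊥ →
           Liftable⇒⊥ (Liftable-＠ (⊥⇒Liftable (T∈U⊸ _ (S , V , 𝕊⊆U S S∈𝕊 , V∈U⊥ , refl)))))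
      , (λ S S∈U →
           Liftable⇒⊥ (Liftable-restrictA (⊥⇒Liftable (T∈U⊸ _ (S , _ , S∈U , idPre∈U⊥ , refl)))))

    sufficient : (∀ S → 𝕊 S → U B (T ＠ S)) × (U A ^⊥) (restrictA T) → U⊸ A B T
    sufficient (T＠𝕊⊆U , T∈U⊥) _ (S , V , S∈U , V∈U⊥ , refl) =
      Liftable⇒⊥ (Liftable-×P (Liftable-restrictB (⊥⇒Liftable (V⊥T＠ _ id∈𝕊)))
                              (Liftable-sym (⊥⇒Liftable (U⊆𝕊⊥⊥ S S∈U _ T＠ᵒᵖV∈𝕊⊥))))
      where
        V⊥T＠ : ∀ S' → 𝕊 S' → V ⊥ (T ＠ S')
        V⊥T＠ S' S'∈𝕊 = proj₂ (closed B) (T ＠ S') (T＠𝕊⊆U S' S'∈𝕊) V V∈U⊥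

        T＠ᵒᵖV∈𝕊⊥ : (𝕊 ^⊥) (T ＠ᵒᵖ V)
        T＠ᵒᵖV∈𝕊⊥ S' S'∈𝕊 = Liftable⇒⊥ (Liftable-＠ᵒᵖ (⊥⇒Liftable (T∈U⊥ S' (𝕊⊆U S' S'∈𝕊)))
                                                       (⊥⇒Liftable (V⊥T＠ S' S'∈𝕊)))
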